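{- Under the standing assumptions below, let $c\in\mathcal{C}_{n-1}(n,q)$ with $\mathrm{wt}(c)\leq W(n,q)$ and suppose that $|\mathcal{P}_c^\infty|\leq|\mathbb{H}_c^\infty|-2$. Then $c$ is not minimal.
   Context: Standing assumptions: $p$ is a prime, $q=p^h$ with $h\geq 2$, $q>27$, $n\geq 2$, and $q\geq\max\{32,2^{2n-4}\}$ if $h>2$, while $q\geq 2^{2n}$ if $h=2$. $\mathrm{PG}(n,q)$ is the Desarguesian projective space over $\mathbb{F}_q$; $\theta_m:=\frac{q^{m+1}-1}{q-1}$. $\mathcal{C}_{n-1}(n,q)$ is the $\mathbb{F}_p$-span of the characteristic functions (values in $\mathbb{F}_p$) of the hyperplanes of $\mathrm{PG}(n,q)$, as functions on points; hyperplanes are identified with their characteristic functions. $\mathrm{supp}(c)=\{P:c(P)\neq0\}$, $\mathrm{wt}(c)=|\mathrm{supp}(c)|$, $m_c:=\lceil\mathrm{wt}(c)/\theta_{n-1}\rceil$. $\Delta_{n,q}:=\lfloor 2^{ -(n-2)}\sqrt{q}\rfloor$ if $h>2$, $\Delta_{n,q}:=\lfloor p/2^n\rfloor$ if $h=2$; $W(n,q):=(\Delta_{n,q}-1)\theta_{n-1}$. For $c$ with $\mathrm{wt}(c)\leq W(n,q)$, $c$ is a linear combination with nonzero coefficients of a uniquely determined set $\mathcal{H}_c$ of exactly $m_c$ distinct hyperplanes, with uniquely determined coefficients; write $c(H)$ for the coefficient of $H\in\mathcal{H}_c$. For $\mathcal{H}\subseteq\mathcal{H}_c$ put $c|_{\mathcal{H}}:=\sum_{H\in\mathcal{H}}c(H)H$.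 Points not in $\mathrm{supp}(c)$ are holes of $c$. For a partition $\mathbb{H}$ of $\mathcal{H}_c$, let $\Gamma_{\mathbb{H}}$ be the graph with vertex set $\mathbb{H}$ in which distinct $\mathcal{H}_1,\mathcal{H}_2$ are adjacent iff there is a point $P$ such that: $P$ is a hole of $c$; $c|_{\mathcal{H}_1}(P)\neq0$ and $c|_{\mathcal{H}_2}(P)\neq0$; and $c|_{\mathcal{H}}(P)=0$ for all $\mathcal{H}\in\mathbb{H}\setminus\{\mathcal{H}_1,\mathcal{H}_2\}$. Let $\mathbb{H}_c^0$ be the partition of $\mathcal{H}_c$ into singletons, and $\mathbb{H}_c^{i+1}$ the partition whose parts are the unions of the parts in each connected component of $\Gamma_{\mathbb{H}_c^i}$. This sequence stabilizes; $\mathbb{H}_c^\infty$ is the eventual constant partition. $\mathcal{P}_c^\infty$ is the set of holes $P$ of $c$ for which there exists $\mathcal{H}\in\mathbb{H}_c^\infty$ with $c|_{\mathcal{H}}(P)\neq0$. A codeword $c$ is minimal if for every $c'\in\mathcal{C}_{n-1}(n,q)$ with $\mathrm{supp}(c')\subseteq\mathrm{supp}(c)$ there is $\alpha\in\mathbb{F}_p$ with $c'=\alpha c$. -}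

module Defs where

open import Data.Nat as ℕ using (ℕ; zero; suc; _≤_; _<_; _∸_; _^_)
open import Data.Nat.DivMod using (_/_)
open import Data.Nat.Divisibility using (_∣_; _∣?_)
open import Data.Integer as ℤ using (ℤ; +_; ∣_∣)
open import Data.Fin as Fin using (Fin; toℕ)
open import Data.Fin.Properties using () renaming (_≟_ to _≟ᶠ_)
open import Data.Vec using (Vec; []; _∷_)
open import Data.List using (List; allFin; []; _∷_; map; concatMap; length; filterᵇ; foldr)
open import Data.Bool.ListAction using (any; all)
open import Data.List.Relation.Unary.All using (All)
open import Data.Bool using (Bool; true; false; _∧_; _∨_; not; if_then_else_; T)
open import Data.Product using (_×_; _,_; proj₁; proj₂; ∃)
open import Relation.Nullary using (¬_; does)
open import Relation.Binary.PropositionalEquality using (_≡_; _≢_)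

-- A field whose carrier is Fin q (so it has exactly q elements).
-- PG(n,q) is built over such a field; every finite field of order q
-- is isomorphic to F_q.

record FiniteField (q : ℕ) : Set where
  infixl 6 _+_
  infixl 7 _*_
  field
    _+_ _*_    : Fin q → Fin q → Fin q
    -_         : Fin q → Fin q
    0# 1#      : Fin q
    +-assoc    : ∀ x y z → (x + y) + z ≡ x + (y + z)
    +-comm     : ∀ x y → x + y ≡ y + x
    +-identityˡ : ∀ x → 0# + x ≡ x
    -‿inverseˡ : ∀ x → (- x) + x ≡ 0#
    *-assoc    : ∀ x y z → (x * y) * z ≡ x * (y * z)
    *-comm     : ∀ x y → x * y ≡ y * x
    *-identityˡ : ∀ x → 1# * x ≡ x
    distribˡ   : ∀ x y z → x * (y + z) ≡ (x * y) + (x * z)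
    0≢1        : 0# ≢ 1#
    inverse    : ∀ x → x ≢ 0# → ∃ λ y → x * y ≡ 1#

-- Δ_{n,q} characterised as the floor it is defined to be:
--  h > 2 :  Δ = ⌊ √q / 2^(n-2) ⌋   i.e.  (Δ·2^(n-2))² ≤ q < ((Δ+1)·2^(n-2))²
--  h = 2 :  Δ = ⌊ p / 2^n ⌋        i.e.  Δ·2^n ≤ p < (Δ+1)·2^n

IsDelta : (p h n q Δ : ℕ) → Set
IsDelta p h n q Δ =
  (2 ℕ.< h → (Δ ℕ.* 2 ^ (n ∸ 2)) ^ 2 ≤ q × q < (suc Δ ℕ.* 2 ^ (n ∸ 2)) ^ 2)
  × (h ≡ 2 → Δ ℕ.* 2 ^ n ≤ p × p < suc Δ ℕ.* 2 ^ n)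

module PG {q : ℕ} (F : FiniteField q) (p n : ℕ) where
  open FiniteField F

  vecs : (k : ℕ) → List (Vec (Fin q) k)
  vecs zero    = [] ∷ []
  vecs (suc k) = concatMap (λ x → map (x ∷_) (vecs k)) (allFin q)

  isNorm : ∀ {k} → Vec (Fin q) k → Bool
  isNorm []       = false
  isNorm (x ∷ xs) = if does (x ≟ᶠ 0#) then isNorm xs else does (x ≟ᶠ 1#)

  -- points of PG(n,q) = normalised representatives in F_q^(n+1);
  -- hyperplanes are given by normalised dual coordinate vectors
  Point : Set
  Point = Vec (Fin q) (suc n)

  IsPoint : Point → Set
  IsPoint v = T (isNorm v)

  points : List Point
  points = filterᵇ isNorm (vecs (suc n))

  dot : ∀ {k} → Vec (Fin q) k → Vec (Fin q) k → Fin q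
  dot []       []       = 0#
  dot (a ∷ as) (x ∷ xs) = a * x + dot as xs

  hyp : Point → Point → ℤ
  hyp a P = if does (dot a P ≟ᶠ 0#) then + 1 else + 0

  -- F_p-values are represented by integers modulo p
  infix 4 _≡ₚ_
  _≡ₚ_ : ℤ → ℤ → Set
  x ≡ₚ y = p ∣ ∣ x ℤ.- y ∣

  isZeroₚ : ℤ → Bool
  isZeroₚ x = does (p ∣? ∣ x ∣)

  Codeword : Set
  Codeword = Point → ℤ

  sumℤ : List ℤ → ℤ
  sumℤ = foldr ℤ._+_ (+ 0)

  evalComb : List (ℤ × Point) → Point → ℤ
  evalComb L P = sumℤ (map (λ ch → proj₁ ch ℤ.* hyp (proj₂ ch) P) L)

  -- membership in C_{n-1}(n,q): an F_p-linear combination of hyperplanes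
  InCode : Codeword → Set
  InCode c = ∃ λ (L : List (ℤ × Point)) →
    All (λ ch → IsPoint (proj₂ ch)) L × (∀ P → IsPoint P → c P ≡ₚ evalComb L P)

  wt : Codeword → ℕ
  wt c = length (filterᵇ (λ P → not (isZeroₚ (c P))) points)

  -- θ_m = (q^(m+1)-1)/(q-1) = 1 + q + … + q^m, written as suc (θpred m)
  θpred : ℕ → ℕ
  θpred zero    = 0
  θpred (suc m) = q ℕ.* suc (θpred m)

  θ : ℕ → ℕ
  θ m = suc (θpred m)

  -- m_c = ⌈ wt(c) / θ_{n-1} ⌉
  mc : Codeword → ℕ
  mc c = (wt c ℕ.+ θpred (n ∸ 1)) / θ (n ∸ 1)

  Minimal : Codeword → Set
  Minimal c = ∀ c' → InCode c' →
    (∀ P → IsPoint P → ¬ (p ∣ ∣ c' P ∣) → ¬ (p ∣ ∣ c P ∣)) →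
    ∃ λ (α : ℤ) → ∀ P → IsPoint P → c' P ≡ₚ (α ℤ.* c P)

  -- A representation of c as Σ_{H ∈ H_c} c(H) H with |H_c| = m_c distinct
  -- hyperplanes and nonzero coefficients (H_c indexed by Fin m).
  record Rep (c : Codeword) : Set where
    field
      m       : ℕ
      H       : Fin m → Point
      coef    : Fin m → ℤ
      H-pt    : ∀ i → IsPoint (H i)
      H-inj   : ∀ i j → H i ≡ H j → i ≡ j
      coef-nz : ∀ i → ¬ (p ∣ ∣ coef i ∣)
      m≡mc    : m ≡ mc c
      c≡sum   : ∀ P → IsPoint P →
                c P ≡ₚ sumℤ (map (λ i → coef i ℤ.* hyp (H i) P) (allFin m))

  module Parts {c : Codeword} (r : Rep c) where
    open Rep r

    -- a partition of H_c, given by its (Boolean) equivalence relation;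
    -- the part containing i is  R i
    Rel : Set
    Rel = Fin m → Fin m → Bool

    restr : (Fin m → Bool) → Point → ℤ
    restr S P = sumℤ (map (λ j → if S j then coef j ℤ.* hyp (H j) P else + 0)
                          (allFin m))

    hole : Point → Bool
    hole P = isZeroₚ (c P)

    adj : Rel → Fin m → Fin m → Bool
    adj R i j = not (R i j) ∧ any (λ P →
        hole P ∧ not (isZeroₚ (restr (R i) P)) ∧ not (isZeroₚ (restr (R j) P))
        ∧ all (λ k → R i k ∨ R j k ∨ isZeroₚ (restr (R k) P)) (allFin m))
      points

    edge : Rel → Rel
    edge R i j = R i j ∨ adj R i j

    reach : Rel → ℕ → Rel
    reach R zero    i j = does (i ≟ᶠ j)
    reach R (suc k) i j = reach R k i j ∨ any (λ l → reach R k i l ∧ edge R l j) (allFin m)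

    -- merge the parts along connected components of Γ_R (m vertices at most)
    step : Rel → Rel
    step R = reach R m

    Hseq : ℕ → Rel
    Hseq zero    i j = does (i ≟ᶠ j)
    Hseq (suc k) = step (Hseq k)

    -- the sequence has become constant at stage K (so ℍ_c^∞ = ℍ_c^K)
    Stable : ℕ → Set
    Stable K = ∀ i j → Hseq (suc K) i j ≡ Hseq K i j

    -- number of parts: count the least element of each part
    leader : Rel → Fin m → Bool
    leader R i = all (λ j → not (does (toℕ j ℕ.<? toℕ i)) ∨ not (R i j)) (allFin m)

    numParts : Rel → ℕ
    numParts R = length (filterᵇ (leader R) (allFin m))

    Pinf : Rel → List Point
    Pinf R = filterᵇ (λ P → hole P ∧ any (λ i → not (isZeroₚ (restr (R i) P))) (allFin m))
               points

-- Let ℓ₀ < ℓ₁ < ⋯ < ℓ_k be the least elements of the parts of ℍ = ℍ_c^∞ and put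
-- c_x = Σ_t x_t · c|_{ℍ_{ℓ_t}} for x ∈ {0, …, p-1}^{k+1} with x_0 = 0. At a hole of c outside
-- 𝒫 = 𝒫_c^∞ every c|_{ℍ_ℓ} vanishes, so whenever c_x and c_x′ agree on 𝒫 their difference is supported
-- in supp(c); as k ≥ |𝒫| + 1, pigeonhole gives such a pair with x ≠ x′. If c were minimal, then
-- c_x - c_x′ = α c. This difference is Σ_j w_j c(H_j) H_j over ℋ_c, and at a point lying on H_j and on no
-- other hyperplane of ℋ_c (one exists because |ℋ_c| = m_c < q) the equation reads w_j c(H_j) = α c(H_j),
-- so every w_j equals α. But w_{ℓ₀} = x_0 - x′_0 = 0, so all weights vanish, and the weights at
-- ℓ₀, ℓ₁, … are unitriangular in x - x′, whence x = x′.

module Submission where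

open import Defs
open import Level using (0ℓ)
open import Data.Nat as ℕ using (ℕ; zero; suc)
import Data.Nat.Properties as ℕ
open import Data.Fin as Fin using (Fin; toℕ)
import Data.Fin.Properties as Finₚ
import Data.Vec.Properties as VecP
open import Data.Vec as Vec using (Vec; []; _∷_)
open import Data.Vec.Relation.Unary.Any as VecAny using (here; there)
open import Data.List as List using (List; length; map; allFin)
import Data.List.Properties as List
open import Data.List.Membership.Propositional using (_∈_; _∉_)
open import Data.List.Membership.Propositional.Properties using (∈-map⁺; ∈-allFin)
import Data.List.Relation.Unary.Any as ListAny
open import Data.List.Relation.Unary.Any.Properties using (lookup-index)
open import Data.Bool using (true; false; T; if_then_else_; not)
import Data.Integer as ℤ
import Data.Integer.Properties as ℤₚ
open import Data.Integer.DivMod using (_%ℕ_; _/ℕ_; n%ℕd<d; a≡a%ℕn+[a/ℕn]*n)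
open import Data.Integer.Divisibility.Signed
  using (divides; ∣ᵤ⇒∣; ∣⇒∣ᵤ; ∣m∣n⇒∣m+n; ∣m∣n⇒∣m-n; ∣n⇒∣m*n; ∣m+n∣m⇒∣n)
  renaming (_∣_ to _∣ℤ_)
open import Data.Integer.Tactic.RingSolver using (solve-∀)
import Data.Nat.Divisibility as ℕ
open import Data.Nat.DivMod using (m<n⇒m%n≡m)
open import Data.Nat.Primality using (Prime; euclidsLemma; prime⇒nonZero; prime⇒nonTrivial)
open import Data.Sum using (inj₁; inj₂)
open import Data.Product using (_×_; _,_; ∃; proj₁; proj₂)
open import Data.Empty using (⊥-elim)
open import Function using (_∘_)
open import Algebra.Bundles using (CommutativeRing)
open import Algebra.Consequences.Propositional using (comm∧distrˡ⇒distrʳ)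
open import Algebra.Consequences.Setoid using (comm∧idˡ⇒id; comm∧invˡ⇒inv)
open import Relation.Nullary using (¬_; Dec; yes; no; does; contradiction; ¬?)
open import Relation.Nullary.Decidable using (decidable-stable; dec-true)
open import Relation.Binary.PropositionalEquality

-- Finite sets

module _ {k : ℕ} where
  open import Data.List.Membership.DecPropositional (Finₚ._≟_ {k}) using (_∈?_)

  length<⇒¬complete : (xs : List (Fin k)) → length xs ℕ.< k → ¬ (∀ y → y ∈ xs)
  length<⇒¬complete xs xs<k all∈
    with i , j , i<j , same ← Finₚ.pigeonhole xs<k (ListAny.index ∘ all∈) =
    Finₚ.<⇒≢ i<j (trans (lookup-index (all∈ i)) (trans (cong (List.lookup xs) same) (sym (lookup-index (all∈ j)))))

  length<⇒∃∉ : (xs : List (Fin k)) → length xs ℕ.< k → ∃ (_∉ xs)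
  length<⇒∃∉ xs xs<k = Finₚ.¬∀⟶∃¬ k (_∈ xs) (_∈? xs) (length<⇒¬complete xs xs<k)

module _ {A : Set} where
  T-does⇒ : (a? : Dec A) → T (does a?) → A
  T-does⇒ (yes a) _ = a

  ⇒T-does : (a? : Dec A) → A → T (does a?)
  ⇒T-does (yes _) _ = _
  ⇒T-does (no ¬a) a = ¬a a

  ¬⇒T-not-does : (a? : Dec A) → ¬ A → T (not (does a?))
  ¬⇒T-not-does (yes a) ¬a = ¬a a
  ¬⇒T-not-does (no _) _ = _

funToFin-cong : ∀ {k a} {f g : Fin k → Fin a} → (∀ t → f t ≡ g t) → Fin.funToFin f ≡ Fin.funToFin g
funToFin-cong {zero} f≗g = refl
funToFin-cong {suc k} f≗g = cong₂ Fin.combine (f≗g Fin.zero) (funToFin-cong (f≗g ∘ Fin.suc))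

collision : ∀ {a k N} → 1 ℕ.< a → k ℕ.< N → (f : (Fin N → Fin a) → Fin k → Fin a) →
  ∃ λ u → ∃ λ v → (∃ λ t → u t ≢ v t) × (∀ s → f u s ≡ f v s)
collision {a} {k} {N} 1<a k<N f
  with i , j , i<j , same ← Finₚ.pigeonhole (ℕ.^-monoʳ-< a 1<a k<N)
                                            (Fin.funToFin {k} {a} ∘ f ∘ Fin.finToFun {a} {N}) =
  decode i , decode j , Finₚ.¬∀⟶∃¬ N _ (λ t → decode i t Finₚ.≟ decode j t) distinct , agree
  where
  open ≡-Reasoning
  decode : Fin (a ℕ.^ N) → Fin N → Fin a
  decode = Fin.finToFun
  distinct : ¬ (∀ t → decode i t ≡ decode j t)
  distinct i≗j = Finₚ.<⇒≢ i<j (begin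
    i                             ≡⟨ sym (Finₚ.funToFin-finToFin {N} {a} i) ⟩
    Fin.funToFin (decode i)       ≡⟨ funToFin-cong i≗j ⟩
    Fin.funToFin (decode j)       ≡⟨ Finₚ.funToFin-finToFin {N} {a} j ⟩
    j                             ∎)
  agree : ∀ s → f (decode i) s ≡ f (decode j) s
  agree s = begin
    f (decode i) s                                ≡⟨ sym (Finₚ.finToFun-funToFin {k} {a} (f (decode i)) s) ⟩
    Fin.finToFun (Fin.funToFin (f (decode i))) s  ≡⟨ cong (λ z → Fin.finToFun z s) same ⟩
    Fin.finToFun (Fin.funToFin (f (decode j))) s  ≡⟨ Finₚ.finToFun-funToFin {k} {a} (f (decode j)) s ⟩
    f (decode j) s                                ∎

<⇒1< : ∀ {k} {i j : Fin k} → i Fin.< j → 1 ℕ.< k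
<⇒1< {j = j} i<j = ℕ.≤-trans (ℕ.s≤s (ℕ.≤-trans (ℕ.s≤s ℕ.z≤n) i<j)) (Finₚ.toℕ<n j)

another : ∀ {k} → 1 ℕ.< k → (j : Fin k) → ∃ (_≢ j)
another {suc (suc k)} _ Fin.zero = Fin.suc Fin.zero , λ ()
another {suc (suc k)} _ (Fin.suc j) = Fin.zero , λ ()
another {suc zero} (ℕ.s≤s ()) _

-- Finite fields

module FiniteFieldProperties {q : ℕ} (F : FiniteField q) where
  open FiniteField F
  open Finₚ using (_≟_)

  commutativeRing : CommutativeRing 0ℓ 0ℓ
  commutativeRing = record
    { isCommutativeRing = record
      { isRing = record
        { +-isAbelianGroup = record
          { isGroup = record
            { isMonoid = record
              { isSemigroup = record
                { isMagma = record { isEquivalence = isEquivalence ; ∙-cong = cong₂ _+_ }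
                ; assoc = +-assoc
                }
              ; identity = comm∧idˡ⇒id (setoid _) +-comm +-identityˡ
              }
            ; inverse = comm∧invˡ⇒inv (setoid _) +-comm -‿inverseˡ
            ; ⁻¹-cong = cong -_
            }
          ; comm = +-comm
          }
        ; *-cong = cong₂ _*_
        ; *-assoc = *-assoc
        ; *-identity = comm∧idˡ⇒id (setoid _) *-comm *-identityˡ
        ; distrib = distribˡ , comm∧distrˡ⇒distrʳ *-comm distribˡ
        }
      ; *-comm = *-comm
      }
    }

  open CommutativeRing commutativeRing public
    using (_-_; +-identityʳ; -‿inverseʳ; *-identityʳ; distribʳ; zeroˡ; zeroʳ; ring; +-commutativeSemigroup)
  open import Algebra.Properties.Ring ring public
    using (-‿distribˡ-*; -‿distribʳ-*; -‿+-comm; +-inverseʳ-unique; x∙y⁻¹≈ε⇒x≈y)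
  open import Algebra.Properties.CommutativeSemigroup +-commutativeSemigroup public
    using () renaming (interchange to +-interchange)

  -- 0# ⁻¹ is a junk value; every use below is guarded by x ≢ 0#.
  _⁻¹ : Fin q → Fin q
  x ⁻¹ with x ≟ 0#
  ... | yes _ = 0#
  ... | no x≢0 = proj₁ (inverse x x≢0)

  ⁻¹-inverseʳ : ∀ {x} → x ≢ 0# → x * x ⁻¹ ≡ 1#
  ⁻¹-inverseʳ {x} x≢0 with x ≟ 0#
  ... | yes x≡0 = contradiction x≡0 x≢0
  ... | no x≢0 = proj₂ (inverse x x≢0)

  ⁻¹-inverseˡ : ∀ {x} → x ≢ 0# → x ⁻¹ * x ≡ 1#
  ⁻¹-inverseˡ {x} x≢0 = trans (*-comm (x ⁻¹) x) (⁻¹-inverseʳ x≢0)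

  *-cancelˡ : ∀ {x y z} → x ≢ 0# → x * y ≡ x * z → y ≡ z
  *-cancelˡ {x} {y} {z} x≢0 xy≡xz = begin
    y                ≡⟨ sym (*-identityˡ y) ⟩
    1# * y           ≡⟨ cong (_* y) (sym (⁻¹-inverseˡ x≢0)) ⟩
    x ⁻¹ * x * y     ≡⟨ *-assoc (x ⁻¹) x y ⟩
    x ⁻¹ * (x * y)   ≡⟨ cong (x ⁻¹ *_) xy≡xz ⟩
    x ⁻¹ * (x * z)   ≡⟨ sym (*-assoc (x ⁻¹) x z) ⟩
    x ⁻¹ * x * z     ≡⟨ cong (_* z) (⁻¹-inverseˡ x≢0) ⟩
    1# * z           ≡⟨ *-identityˡ z ⟩
    z                ∎
    where open ≡-Reasoning

  *-nonzero : ∀ {x y} → x ≢ 0# → y ≢ 0# → x * y ≢ 0#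
  *-nonzero {x} {y} x≢0 y≢0 xy≡0 = y≢0 (*-cancelˡ x≢0 (trans xy≡0 (sym (zeroʳ x))))

  linear-root : ∀ {c y e} → c ≢ 0# → c * y + e ≡ 0# → y ≡ - e * c ⁻¹
  linear-root {c} {y} {e} c≢0 root = *-cancelˡ c≢0 (begin
    c * y               ≡⟨ +-inverseʳ-unique e (c * y) (trans (+-comm e (c * y)) root) ⟩
    - e                 ≡⟨ sym (*-identityʳ (- e)) ⟩
    - e * 1#            ≡⟨ cong (- e *_) (sym (⁻¹-inverseʳ c≢0)) ⟩
    - e * (c * c ⁻¹)    ≡⟨ sym (*-assoc (- e) c (c ⁻¹)) ⟩
    - e * c * c ⁻¹      ≡⟨ cong (_* c ⁻¹) (*-comm (- e) c) ⟩
    c * - e * c ⁻¹      ≡⟨ *-assoc c (- e) (c ⁻¹) ⟩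
    c * (- e * c ⁻¹)    ∎)
    where open ≡-Reasoning

-- Points of PG(n, q) avoiding fewer than q hyperplanes

module Geometry {q : ℕ} (F : FiniteField q) (p n : ℕ) where
  open FiniteField F
  open FiniteFieldProperties F
  open PG F p n using (dot; isNorm; Point; IsPoint; hyp)
  open Finₚ using (_≟_)

  Nonzero : ∀ {d} → Vec (Fin q) d → Set
  Nonzero = VecAny.Any (_≢ 0#)

  nonzero? : ∀ {d} (v : Vec (Fin q) d) → Dec (Nonzero v)
  nonzero? = VecAny.any? (λ x → ¬? (x ≟ 0#))

  scale : ∀ {d} → Fin q → Vec (Fin q) d → Vec (Fin q) d
  scale t = Vec.map (t *_)

  _-ᵛ_ : ∀ {d} → Vec (Fin q) d → Vec (Fin q) d → Vec (Fin q) d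
  _-ᵛ_ = Vec.zipWith _-_

  ¬Nonzero-difference⇒≡ : ∀ {d} (u v : Vec (Fin q) d) → ¬ Nonzero (u -ᵛ v) → u ≡ v
  ¬Nonzero-difference⇒≡ [] [] _ = refl
  ¬Nonzero-difference⇒≡ (x ∷ u) (y ∷ v) ¬nz =
    cong₂ _∷_ (x∙y⁻¹≈ε⇒x≈y x y (decidable-stable (x - y ≟ 0#) (¬nz ∘ here)))
              (¬Nonzero-difference⇒≡ u v (¬nz ∘ there))

  dot-scaleʳ : ∀ {d} (a v : Vec (Fin q) d) t → dot a (scale t v) ≡ t * dot a v
  dot-scaleʳ [] [] t = sym (zeroʳ t)
  dot-scaleʳ (a ∷ as) (x ∷ xs) t = begin
    a * (t * x) + dot as (scale t xs)  ≡⟨ cong₂ _+_ (sym (*-assoc a t x)) (dot-scaleʳ as xs t) ⟩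
    a * t * x + t * dot as xs          ≡⟨ cong (λ z → z * x + t * dot as xs) (*-comm a t) ⟩
    t * a * x + t * dot as xs          ≡⟨ cong (_+ t * dot as xs) (*-assoc t a x) ⟩
    t * (a * x) + t * dot as xs        ≡⟨ sym (distribˡ t (a * x) (dot as xs)) ⟩
    t * (a * x + dot as xs)            ∎
    where open ≡-Reasoning

  dot-differenceˡ : ∀ {d} (b a v : Vec (Fin q) d) c → dot (b -ᵛ scale c a) v ≡ dot b v - c * dot a v
  dot-differenceˡ [] [] [] c = sym (trans (cong (λ z → 0# - z) (zeroʳ c)) (-‿inverseʳ 0#))
  dot-differenceˡ (b ∷ bs) (a ∷ as) (x ∷ xs) c = begin
    (b - c * a) * x + dot (bs -ᵛ scale c as) xs
      ≡⟨ cong₂ _+_ (distribʳ x b (- (c * a))) (dot-differenceˡ bs as xs c) ⟩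
    (b * x + - (c * a) * x) + (dot bs xs - c * dot as xs)
      ≡⟨ +-interchange (b * x) (- (c * a) * x) (dot bs xs) (- (c * dot as xs)) ⟩
    (b * x + dot bs xs) + (- (c * a) * x + - (c * dot as xs))
      ≡⟨ cong (λ z → (b * x + dot bs xs) + (z + - (c * dot as xs))) (sym (-‿distribˡ-* (c * a) x)) ⟩
    (b * x + dot bs xs) + (- (c * a * x) + - (c * dot as xs))
      ≡⟨ cong ((b * x + dot bs xs) +_) (-‿+-comm (c * a * x) (c * dot as xs)) ⟩
    (b * x + dot bs xs) - (c * a * x + c * dot as xs)
      ≡⟨ cong (λ z → (b * x + dot bs xs) - (z + c * dot as xs)) (*-assoc c a x) ⟩
    (b * x + dot bs xs) - (c * (a * x) + c * dot as xs)
      ≡⟨ cong (λ z → (b * x + dot bs xs) - z) (sym (distribˡ c (a * x) (dot as xs))) ⟩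
    (b * x + dot bs xs) - c * (a * x + dot as xs)
      ∎
    where open ≡-Reasoning

  dot≢0⇒Nonzeroʳ : ∀ {d} (a v : Vec (Fin q) d) → dot a v ≢ 0# → Nonzero v
  dot≢0⇒Nonzeroʳ [] [] a·v≢0 = contradiction refl a·v≢0
  dot≢0⇒Nonzeroʳ (a ∷ as) (x ∷ xs) a·v≢0 with x ≟ 0#
  ... | no x≢0 = here x≢0
  ... | yes x≡0 = there (dot≢0⇒Nonzeroʳ as xs (a·v≢0 ∘ vanishes))
    where
    open ≡-Reasoning
    vanishes : dot as xs ≡ 0# → a * x + dot as xs ≡ 0#
    vanishes as·xs≡0 = begin
      a * x + dot as xs  ≡⟨ cong₂ (λ z w → a * z + w) x≡0 as·xs≡0 ⟩
      a * 0# + 0#        ≡⟨ +-identityʳ (a * 0#) ⟩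
      a * 0#             ≡⟨ zeroʳ a ⟩
      0#                 ∎

  isNorm-∷-zero : ∀ {d z} (s : Vec (Fin q) d) → z ≡ 0# → isNorm (z ∷ s) ≡ isNorm s
  isNorm-∷-zero {z = z} s z≡0 with z ≟ 0#
  ... | yes _ = refl
  ... | no z≢0 = contradiction z≡0 z≢0

  isNorm-∷-nonzero : ∀ {d z} (s : Vec (Fin q) d) → z ≢ 0# → isNorm (z ∷ s) ≡ does (z ≟ 1#)
  isNorm-∷-nonzero {z = z} s z≢0 with z ≟ 0#
  ... | yes z≡0 = contradiction z≡0 z≢0
  ... | no _ = refl

  isNorm⇒Nonzero : ∀ {d} (v : Vec (Fin q) d) → T (isNorm v) → Nonzero v
  isNorm⇒Nonzero (x ∷ v) norm with x ≟ 0#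
  ... | yes _ = there (isNorm⇒Nonzero v norm)
  ... | no x≢0 = here x≢0

  scale-zero-¬Nonzero : ∀ {d} (v : Vec (Fin q) d) → ¬ Nonzero (scale 0# v)
  scale-zero-¬Nonzero (x ∷ v) (here 0x≢0) = 0x≢0 (zeroˡ x)
  scale-zero-¬Nonzero (x ∷ v) (there nz) = scale-zero-¬Nonzero v nz

  scale-one : ∀ {d} (v : Vec (Fin q) d) → scale 1# v ≡ v
  scale-one [] = refl
  scale-one (x ∷ v) = cong₂ _∷_ (*-identityˡ x) (scale-one v)

  normalise : ∀ {d} (v : Vec (Fin q) d) → Nonzero v → ∃ λ t → t ≢ 0# × T (isNorm (scale t v))
  normalise (x ∷ v) nz with x ≟ 0# | nz
  ... | yes x≡0 | here x≢0 = contradiction x≡0 x≢0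
  ... | yes x≡0 | there nz′ with t , t≢0 , norm ← normalise v nz′ =
    t , t≢0 , subst T (sym (isNorm-∷-zero (scale t v) (trans (cong (t *_) x≡0) (zeroʳ t)))) norm
  ... | no x≢0 | _ = x ⁻¹ , x⁻¹≢0 ,
    subst T (sym (isNorm-∷-nonzero (scale (x ⁻¹) v) x⁻¹x≢0)) (⇒T-does (x ⁻¹ * x ≟ 1#) (⁻¹-inverseˡ x≢0))
    where
    x⁻¹x≢0 : x ⁻¹ * x ≢ 0#
    x⁻¹x≢0 x⁻¹x≡0 = 0≢1 (trans (sym x⁻¹x≡0) (⁻¹-inverseˡ x≢0))
    x⁻¹≢0 : x ⁻¹ ≢ 0#
    x⁻¹≢0 x⁻¹≡0 = x⁻¹x≢0 (trans (cong (_* x) x⁻¹≡0) (zeroˡ x))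

  scale-normalised : ∀ {d} t (a : Vec (Fin q) d) → T (isNorm a) → T (isNorm (scale t a)) → scale t a ≡ a
  scale-normalised t (x ∷ a) norm tnorm with x ≟ 0#
  ... | yes x≡0 = cong₂ _∷_ (trans tx≡0 (sym x≡0))
                    (scale-normalised t a norm (subst T (isNorm-∷-zero (scale t a) tx≡0) tnorm))
    where
    tx≡0 : t * x ≡ 0#
    tx≡0 = trans (cong (t *_) x≡0) (zeroʳ t)
  ... | no x≢0 with t ≟ 0#
  ...   | yes t≡0 = contradiction (subst Nonzero (cong (λ s → scale s (x ∷ a)) t≡0) (isNorm⇒Nonzero _ tnorm))
                                  (scale-zero-¬Nonzero (x ∷ a))
  ...   | no t≢0 = trans (cong (λ s → scale s (x ∷ a)) t≡1) (scale-one (x ∷ a))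
    where
    x≡1 : x ≡ 1#
    x≡1 = T-does⇒ (x ≟ 1#) norm
    tx≡1 : t * x ≡ 1#
    tx≡1 = T-does⇒ (t * x ≟ 1#) (subst T (isNorm-∷-nonzero (scale t a) (*-nonzero t≢0 x≢0)) tnorm)
    t≡1 : t ≡ 1#
    t≡1 = trans (sym (*-identityʳ t)) (trans (cong (t *_) (sym x≡1)) tx≡1)

  length-map-< : ∀ {A B : Set} (f : A → B) (xs : List A) → length xs ℕ.< q → length (map f xs) ℕ.< q
  length-map-< f xs = subst (ℕ._< q) (sym (List.length-map f xs))

  affine-root : Fin q × Fin q → Fin q
  affine-root (c , e) = - e * c ⁻¹

  affine-avoid : (ps : List (Fin q × Fin q)) → length ps ℕ.< q →
    ∃ λ y → ∀ {c e} → (c , e) ∈ ps → c * y + e ≡ 0# → c ≡ 0# × e ≡ 0#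
  affine-avoid ps ps<q with y , y∉roots ← length<⇒∃∉ (map affine-root ps) (length-map-< affine-root ps ps<q) =
    y , only-zero
    where
    only-zero : ∀ {c e} → (c , e) ∈ ps → c * y + e ≡ 0# → c ≡ 0# × e ≡ 0#
    only-zero {c} {e} ce∈ps vanishes with c ≟ 0#
    ... | no c≢0 = contradiction
      (subst (_∈ map affine-root ps) (sym (linear-root c≢0 vanishes)) (∈-map⁺ affine-root ce∈ps)) y∉roots
    ... | yes c≡0 = c≡0 , (begin
      e           ≡⟨ sym (+-identityˡ e) ⟩
      0# + e      ≡⟨ cong (_+ e) (sym (trans (cong (_* y) c≡0) (zeroˡ y))) ⟩
      c * y + e   ≡⟨ vanishes ⟩
      0#          ∎)
      where open ≡-Reasoning

  -- The affine function y ↦ g · (y ∷ w), as (coefficient , constant term).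
  slice : ∀ {d} → Vec (Fin q) d → Vec (Fin q) (suc d) → Fin q × Fin q
  slice w g = Vec.head g , dot (Vec.tail g) w

  nonvanishing-point : ∀ {d} (gs : List (Vec (Fin q) d)) → length gs ℕ.< q →
    ∃ λ w → ∀ {g} → g ∈ gs → Nonzero g → dot g w ≢ 0#
  nonvanishing-point {zero} gs gs<q = [] , λ _ ()
  nonvanishing-point {suc d} gs gs<q
    with w , w-ok ← nonvanishing-point (map Vec.tail gs) (length-map-< Vec.tail gs gs<q)
    with y , y-ok ← affine-avoid (map (slice w) gs) (length-map-< (slice w) gs gs<q) = y ∷ w , nonvanishing
    where
    nonvanishing : ∀ {g} → g ∈ gs → Nonzero g → dot g (y ∷ w) ≢ 0#
    nonvanishing {c ∷ h} g∈gs nz vanishes with y-ok (∈-map⁺ (slice w) g∈gs) vanishes | nz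
    ... | c≡0 , _ | here c≢0 = c≢0 c≡0
    ... | _ , h·w≡0 | there nzh = w-ok (∈-map⁺ Vec.tail g∈gs) nzh h·w≡0

  -- For a = 1 ∷ a′: (c ∷ b′) · (- a′ · w ∷ w) = (b′ - c a′) · w, which removes the first coordinate.
  eliminate : ∀ {d} → Vec (Fin q) d → Vec (Fin q) (suc d) → Vec (Fin q) d
  eliminate a (c ∷ b) = b -ᵛ scale c a

  point-on-avoiding : ∀ {d} (a : Vec (Fin q) d) → T (isNorm a) → (bs : List (Vec (Fin q) d)) → length bs ℕ.< q →
    ∃ λ v → dot a v ≡ 0# × (∀ {b} → b ∈ bs → (∀ t → b ≢ scale t a) → dot b v ≢ 0#)
  point-on-avoiding (x ∷ a) norm bs bs<q with x ≟ 0#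
  ... | yes x≡0
    with v , on , avoids ← point-on-avoiding a norm (map Vec.tail bs) (length-map-< Vec.tail bs bs<q)
    with y , y-ok ← affine-avoid (map (slice v) bs) (length-map-< (slice v) bs bs<q) = y ∷ v , on′ , avoids′
    where
    on′ : x * y + dot a v ≡ 0#
    on′ = trans (cong₂ _+_ (trans (cong (_* y) x≡0) (zeroˡ y)) on) (+-identityˡ 0#)
    avoids′ : ∀ {b} → b ∈ bs → (∀ t → b ≢ scale t (x ∷ a)) → dot b (y ∷ v) ≢ 0#
    avoids′ {c ∷ b} b∈bs not-multiple vanishes with c≡0 , b·v≡0 ← y-ok (∈-map⁺ (slice v) b∈bs) vanishes =
      avoids (∈-map⁺ Vec.tail b∈bs) (λ t b≡ta → not-multiple t (cong₂ _∷_ (trans c≡0 (sym tx≡0)) b≡ta))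
             b·v≡0
      where
      tx≡0 : ∀ {t} → t * x ≡ 0#
      tx≡0 {t} = trans (cong (t *_) x≡0) (zeroʳ t)
  ... | no x≢0
    with w , w-ok ← nonvanishing-point (map (eliminate a) bs) (length-map-< (eliminate a) bs bs<q) =
    - dot a w ∷ w , on , avoids
    where
    x≡1 : x ≡ 1#
    x≡1 = T-does⇒ (x ≟ 1#) norm
    on : x * - dot a w + dot a w ≡ 0#
    on = trans (cong (λ z → z * - dot a w + dot a w) x≡1)
               (trans (cong (_+ dot a w) (*-identityˡ (- dot a w))) (-‿inverseˡ (dot a w)))
    avoids : ∀ {b} → b ∈ bs → (∀ t → b ≢ scale t (x ∷ a)) → dot b (- dot a w ∷ w) ≢ 0#
    avoids {c ∷ b} b∈bs not-multiple vanishes = w-ok (∈-map⁺ (eliminate a) b∈bs) reduced≢0 (begin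
      dot (b -ᵛ scale c a) w        ≡⟨ dot-differenceˡ b a w c ⟩
      dot b w - c * dot a w         ≡⟨ cong (dot b w +_) (-‿distribʳ-* c (dot a w)) ⟩
      dot b w + c * - dot a w       ≡⟨ +-comm (dot b w) (c * - dot a w) ⟩
      c * - dot a w + dot b w       ≡⟨ vanishes ⟩
      0#                            ∎)
      where
      open ≡-Reasoning
      reduced≢0 : Nonzero (b -ᵛ scale c a)
      reduced≢0 = decidable-stable (nonzero? _) λ ¬nz →
        not-multiple c (cong₂ _∷_ (sym (trans (cong (c *_) x≡1) (*-identityʳ c)))
                                  (¬Nonzero-difference⇒≡ b (scale c a) ¬nz))

  vector-on-only : ∀ {m} (H : Fin m → Point) → (∀ i → IsPoint (H i)) → (∀ i j → H i ≡ H j → i ≡ j) →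
    m ℕ.< q → ∀ j → ∃ λ v → dot (H j) v ≡ 0# × (∀ i → i ≢ j → dot (H i) v ≢ 0#)
  vector-on-only {m} H H-pt H-inj m<q j
    with v , on , avoids ← point-on-avoiding (H j) (H-pt j) (map H (allFin m))
           (subst (ℕ._< q) (sym (trans (List.length-map H (allFin m)) (List.length-tabulate (λ i → i)))) m<q) =
    v , on , off
    where
    off : ∀ i → i ≢ j → dot (H i) v ≢ 0#
    off i i≢j = avoids (∈-map⁺ H (∈-allFin i)) λ t Hi≡tHj →
      i≢j (H-inj i j (trans Hi≡tHj (scale-normalised t (H j) (H-pt j) (subst (T ∘ isNorm) Hi≡tHj (H-pt i)))))

  -- A second hyperplane guarantees that the vector on H_j alone is nonzero.
  isolated-point : ∀ {m} (H : Fin m → Point) → (∀ i → IsPoint (H i)) → (∀ i j → H i ≡ H j → i ≡ j) →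
    1 ℕ.< m → m ℕ.< q → ∀ j →
    ∃ λ P → IsPoint P × dot (H j) P ≡ 0# × (∀ i → i ≢ j → dot (H i) P ≢ 0#)
  isolated-point H H-pt H-inj 1<m m<q j
    with v , on , off ← vector-on-only H H-pt H-inj m<q j
    with i₀ , i₀≢j ← another 1<m j
    with t , t≢0 , norm ← normalise v (dot≢0⇒Nonzeroʳ (H i₀) v (off i₀ i₀≢j)) =
    scale t v , norm , trans (dot-scaleʳ (H j) v t) (trans (cong (t *_) on) (zeroʳ t)) ,
    λ i i≢j → *-nonzero t≢0 (off i i≢j) ∘ trans (sym (dot-scaleʳ (H i) v t))

  hyp-on : ∀ a P → dot a P ≡ 0# → hyp a P ≡ ℤ.+ 1
  hyp-on a P on with dot a P ≟ 0#
  ... | yes _ = refl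
  ... | no off = contradiction on off

  hyp-off : ∀ a P → dot a P ≢ 0# → hyp a P ≡ ℤ.+ 0
  hyp-off a P off with dot a P ≟ 0#
  ... | yes on = contradiction on off
  ... | no _ = refl

-- Integers modulo p

module Residues (p : ℕ) (prime : Prime p) where
  open import Data.Integer using (ℤ; +_; ∣_∣; _+_; _*_; _-_)

  instance
    p≢0 : ℕ.NonZero p
    p≢0 = prime⇒nonZero prime

  ∣m*n∧∤n⇒∣m : ∀ m n → + p ∣ℤ m * n → ¬ (+ p ∣ℤ n) → + p ∣ℤ m
  ∣m*n∧∤n⇒∣m m n p∣mn p∤n
    with euclidsLemma ∣ m ∣ ∣ n ∣ prime (subst (p ℕ.∣_) (ℤₚ.abs-* m n) (∣⇒∣ᵤ p∣mn))
  ... | inj₁ p∣m = ∣ᵤ⇒∣ p∣m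
  ... | inj₂ p∣n = contradiction (∣ᵤ⇒∣ p∣n) p∤n

  residue : ℤ → Fin p
  residue x = Fin.fromℕ< (n%ℕd<d x p)

  residue-≡⇒∣- : ∀ x y → residue x ≡ residue y → + p ∣ℤ x - y
  residue-≡⇒∣- x y same = divides (x /ℕ p - y /ℕ p) (begin
    x - y
      ≡⟨ cong₂ _-_ (a≡a%ℕn+[a/ℕn]*n x p) (a≡a%ℕn+[a/ℕn]*n y p) ⟩
    (+ (x %ℕ p) + x /ℕ p * + p) - (+ (y %ℕ p) + y /ℕ p * + p)
      ≡⟨ cong (λ r → (+ (x %ℕ p) + x /ℕ p * + p) - (+ r + y /ℕ p * + p)) (sym same-remainder) ⟩
    (+ (x %ℕ p) + x /ℕ p * + p) - (+ (x %ℕ p) + y /ℕ p * + p)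
      ≡⟨ cancel (+ (x %ℕ p)) (x /ℕ p) (y /ℕ p) (+ p) ⟩
    (x /ℕ p - y /ℕ p) * + p
      ∎)
    where
    open ≡-Reasoning
    same-remainder : x %ℕ p ≡ y %ℕ p
    same-remainder = trans (sym (Finₚ.toℕ-fromℕ< _)) (trans (cong toℕ same) (Finₚ.toℕ-fromℕ< _))
    cancel : ∀ r a b d → (r + a * d) - (r + b * d) ≡ (a - b) * d
    cancel = solve-∀

  ∣-difference⇒≡ : (a b : Fin p) → + p ∣ℤ + toℕ a - + toℕ b → a ≡ b
  ∣-difference⇒≡ a b p∣a-b =
    Finₚ.toℕ-injective (ℤₚ.+-injective (ℤₚ.i-j≡0⇒i≡j _ _ (ℤₚ.∣i∣≡0⇒i≡0 distance≡0)))
    where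
    distance<p : ∣ + toℕ a - + toℕ b ∣ ℕ.< p
    distance<p = subst (ℕ._< p) (cong ∣_∣ (sym (ℤₚ.m-n≡m⊖n (toℕ a) (toℕ b))))
      (ℕ.≤-<-trans (ℤₚ.∣m⊝n∣≤m⊔n (toℕ a) (toℕ b)) (ℕ.⊔-lub (Finₚ.toℕ<n a) (Finₚ.toℕ<n b)))
    distance≡0 : ∣ + toℕ a - + toℕ b ∣ ≡ 0
    distance≡0 = trans (sym (m<n⇒m%n≡m distance<p)) (ℕ.n∣m⇒m%n≡0 _ p (∣⇒∣ᵤ p∣a-b))

module IntegerSums where
  open import Data.Integer using (ℤ; +_; _+_)
  open import Algebra.Properties.Semiring.Sum ℤₚ.+-*-semiring public
    using (sum; ∑-distrib-+; *-distribˡ-sum; sum-cong-≗; sum-replicate-zero; sum-remove)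

  sum-tabulate : ∀ {k} (f : Fin k → ℤ) → List.foldr _+_ (+ 0) (List.tabulate f) ≡ sum f
  sum-tabulate {zero} f = refl
  sum-tabulate {suc k} f = cong (λ s → f Fin.zero + s) (sum-tabulate (f ∘ Fin.suc))

  sum-allFin : ∀ {k} (f : Fin k → ℤ) → List.foldr _+_ (+ 0) (map f (allFin k)) ≡ sum f
  sum-allFin f = trans (cong (List.foldr _+_ (+ 0)) (List.map-tabulate (λ i → i) f)) (sum-tabulate f)

  sum-single : ∀ {k} (f : Fin k → ℤ) j → (∀ i → i ≢ j → f i ≡ + 0) → sum f ≡ f j
  sum-single {suc k} f j off = begin
    sum f                  ≡⟨ sum-remove f ⟩
    f j + sum (removeAt f j) ≡⟨ cong (λ s → f j + s) (trans (sum-cong-≗ rest-vanishes) (sum-replicate-zero k)) ⟩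
    f j + + 0              ≡⟨ ℤₚ.+-identityʳ (f j) ⟩
    f j                    ∎
    where
    open ≡-Reasoning
    open import Data.Vec.Functional using (removeAt)
    rest-vanishes : ∀ i → removeAt f j i ≡ + 0
    rest-vanishes i = off (Fin.punchIn j i) (Finₚ.punchInᵢ≢i j i)

-- Reweighting the hyperplanes of ℋ_c

module Reweighting {q : ℕ} (F : FiniteField q) (p n : ℕ) (prime : Prime p)
                   {c : PG.Codeword F p n} (r : PG.Rep F p n c) where
  open import Data.Integer using (ℤ; +_; ∣_∣; _+_; _*_; _-_)
  open PG F p n
  open Rep r
  open Geometry F p n using (isolated-point; hyp-on; hyp-off)
  open Residues p prime
  open IntegerSums
  import Data.List.Relation.Unary.All.Properties as All

  weighted : (Fin m → ℤ) → Codeword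
  weighted w P = sumℤ (map (λ i → w i * coef i * hyp (H i) P) (allFin m))

  ≡⇒≡ₚ : ∀ {x y} → x ≡ y → x ≡ₚ y
  ≡⇒≡ₚ {x} refl = subst (λ z → p ℕ.∣ ∣ z ∣) (sym (ℤₚ.+-inverseʳ x)) (p ℕ.∣0)

  weighted-∈-code : ∀ w → InCode (weighted w)
  weighted-∈-code w =
    map (λ i → w i * coef i , H i) (allFin m) ,
    All.map⁺ (All.tabulate⁺ H-pt) ,
    λ P _ → ≡⇒≡ₚ (cong sumℤ (List.map-∘ (allFin m)))

  sum-at-isolated : ∀ {P} j → hyp (H j) P ≡ + 1 → (∀ i → i ≢ j → hyp (H i) P ≡ + 0) →
    (g : Fin m → ℤ) → sumℤ (map (λ i → g i * hyp (H i) P) (allFin m)) ≡ g j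
  sum-at-isolated {P} j on off g = begin
    sumℤ (map (λ i → g i * hyp (H i) P) (allFin m))  ≡⟨ sum-allFin (λ i → g i * hyp (H i) P) ⟩
    sum (λ i → g i * hyp (H i) P)                    ≡⟨ sum-single _ j others-vanish ⟩
    g j * hyp (H j) P                                ≡⟨ trans (cong (g j *_) on) (ℤₚ.*-identityʳ (g j)) ⟩
    g j                                              ∎
    where
    open ≡-Reasoning
    others-vanish : ∀ i → i ≢ j → g i * hyp (H i) P ≡ + 0
    others-vanish i i≢j = trans (cong (g i *_) (off i i≢j)) (ℤₚ.*-zeroʳ (g i))

  -- At a point on H_j alone, c′ = w_j c(H_j) and c = c(H_j), so c′ = α c forces w_j ≡ α.
  minimal⇒weights-congruent : m ℕ.< q → 1 ℕ.< m → Minimal c → (w : Fin m → ℤ) →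
    (∀ P → IsPoint P → p ℕ.∣ ∣ c P ∣ → + p ∣ℤ weighted w P) → ∀ i j → + p ∣ℤ w i - w j
  minimal⇒weights-congruent m<q 1<m minimal w supported i j
    with α , c′≡αc ← minimal (weighted w) (weighted-∈-code w)
                             (λ P isP p∤c′ p∣c → p∤c′ (∣⇒∣ᵤ (supported P isP p∣c))) =
    subst (+ p ∣ℤ_) (shift (w i) (w j) α) (∣m∣n⇒∣m-n (w≡α i) (w≡α j))
    where
    shift : ∀ a b α → (a - α) - (b - α) ≡ a - b
    shift = solve-∀
    split : ∀ x α c a → (x - α) * a ≡ (x * a - α * c) + α * (c - a)
    split = solve-∀
    w≡α : ∀ j → + p ∣ℤ w j - α
    w≡α j with P , isP , on , off ← isolated-point H H-pt H-inj 1<m m<q j =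
      ∣m*n∧∤n⇒∣m (w j - α) (coef j)
        (subst (+ p ∣ℤ_) (sym (split (w j) α (c P) (coef j)))
          (∣m∣n⇒∣m+n (subst (λ z → + p ∣ℤ z - α * c P) c′P≡w·coef (∣ᵤ⇒∣ (c′≡αc P isP)))
                     (∣n⇒∣m*n α p∣cP-coef)))
        (coef-nz j ∘ ∣⇒∣ᵤ)
      where
      on′ : hyp (H j) P ≡ + 1
      on′ = hyp-on (H j) P on
      off′ : ∀ i → i ≢ j → hyp (H i) P ≡ + 0
      off′ i i≢j = hyp-off (H i) P (off i i≢j)
      c′P≡w·coef : weighted w P ≡ w j * coef j
      c′P≡w·coef = sum-at-isolated j on′ off′ (λ i → w i * coef i)
      p∣cP-coef : + p ∣ℤ c P - coef j
      p∣cP-coef = subst (λ z → + p ∣ℤ c P - z) (sum-at-isolated j on′ off′ coef) (∣ᵤ⇒∣ (c≡sum P isP))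

  open Parts r using (Rel; restr; leader)

  module Combinations (R : Rel) (R-refl : ∀ i → R i i ≡ true) where
    open import Data.List.Relation.Unary.All as All using (All; []; _∷_)
    open import Data.List.Relation.Unary.AllPairs as AllPairs using (AllPairs; []; _∷_)
    open import Data.List.Relation.Unary.Any using (here; there)
    open import Data.List.Membership.Propositional.Properties using (∈-allFin)
    open import Data.List using ([]; _∷_)

    -- combo L x = Σ_t x_t · c|_{ℍ_{L_t}}, which puts the weight weight L x j on c(H_j) H_j.
    combo : (L : List (Fin m)) → (Fin (length L) → ℤ) → Codeword
    combo [] x P = + 0
    combo (ℓ ∷ L) x P = x Fin.zero * restr (R ℓ) P + combo L (x ∘ Fin.suc) P

    weight : (L : List (Fin m)) → (Fin (length L) → ℤ) → Fin m → ℤ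
    weight [] x j = + 0
    weight (ℓ ∷ L) x j = (if R ℓ j then x Fin.zero else + 0) + weight L (x ∘ Fin.suc) j

    combo-difference : ∀ L x y P → combo L x P - combo L y P ≡ combo L (λ t → x t - y t) P
    combo-difference [] x y P = refl
    combo-difference (ℓ ∷ L) x y P =
      trans (rearrange (x Fin.zero) (y Fin.zero) (restr (R ℓ) P) _ _)
            (cong (λ s → (x Fin.zero - y Fin.zero) * restr (R ℓ) P + s)
                  (combo-difference L (x ∘ Fin.suc) (y ∘ Fin.suc) P))
      where
      rearrange : ∀ a b r A B → (a * r + A) - (b * r + B) ≡ (a - b) * r + (A - B)
      rearrange = solve-∀

    combo-∣ : ∀ L x P → (∀ ℓ → + p ∣ℤ restr (R ℓ) P) → + p ∣ℤ combo L x P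
    combo-∣ [] x P _ = divides (+ 0) refl
    combo-∣ (ℓ ∷ L) x P p∣restr =
      ∣m∣n⇒∣m+n (∣n⇒∣m*n (x Fin.zero) (p∣restr ℓ)) (combo-∣ L (x ∘ Fin.suc) P p∣restr)

    combo≡weighted : ∀ L x P → combo L x P ≡ weighted (weight L x) P
    combo≡weighted [] x P = sym (trans (sum-allFin (λ i → + 0 * coef i * hyp (H i) P)) (sum-replicate-zero m))
    combo≡weighted (ℓ ∷ L) x P = begin
      x₀ * restr (R ℓ) P + combo L (x ∘ Fin.suc) P
        ≡⟨ cong₂ (λ s t → x₀ * s + t) (sum-allFin f)
                 (trans (combo≡weighted L (x ∘ Fin.suc) P) (sum-allFin g)) ⟩
      x₀ * sum f + sum g
        ≡⟨ cong (_+ sum g) (*-distribˡ-sum x₀ f) ⟩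
      sum (λ i → x₀ * f i) + sum g
        ≡⟨ sym (∑-distrib-+ (λ i → x₀ * f i) g) ⟩
      sum (λ i → x₀ * f i + g i)
        ≡⟨ sum-cong-≗ (λ i → merge (R ℓ i) x₀ (weight L (x ∘ Fin.suc) i) (coef i) (hyp (H i) P)) ⟩
      sum (λ i → weight (ℓ ∷ L) x i * coef i * hyp (H i) P)
        ≡⟨ sym (sum-allFin (λ i → weight (ℓ ∷ L) x i * coef i * hyp (H i) P)) ⟩
      weighted (weight (ℓ ∷ L) x) P
        ∎
      where
      open ≡-Reasoning
      x₀ : ℤ
      x₀ = x Fin.zero
      f g : Fin m → ℤ
      f i = if R ℓ i then coef i * hyp (H i) P else + 0
      g i = weight L (x ∘ Fin.suc) i * coef i * hyp (H i) P
      merge : ∀ b x w a h → x * (if b then a * h else + 0) + w * a * h ≡ ((if b then x else + 0) + w) * a * h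
      merge true = merge-true
        where
        merge-true : ∀ x w a h → x * (a * h) + w * a * h ≡ (x + w) * a * h
        merge-true = solve-∀
      merge false = merge-false
        where
        merge-false : ∀ x w a h → x * + 0 + w * a * h ≡ (+ 0 + w) * a * h
        merge-false = solve-∀

    leader-unrelated-below : ∀ {ℓ j} → T (leader R ℓ) → j Fin.< ℓ → R ℓ j ≡ false
    leader-unrelated-below {ℓ} {j} lead j<ℓ
      with All.lookup (All.all⁺ _ (allFin m) lead) (∈-allFin j)
    ... | below-or-unrelated rewrite dec-true (toℕ j ℕ.<? toℕ ℓ) j<ℓ with R ℓ j
    ...   | true = ⊥-elim below-or-unrelated
    ...   | false = refl

    leaders-unrelated : ∀ {ℓ L} → All (T ∘ leader R) L → All (ℓ Fin.<_) L →
      All (λ ℓ′ → R ℓ′ ℓ ≡ false) L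
    leaders-unrelated [] [] = []
    leaders-unrelated (lead ∷ leads) (ℓ<ℓ′ ∷ above) =
      leader-unrelated-below lead ℓ<ℓ′ ∷ leaders-unrelated leads above

    weight-unrelated : ∀ L x j → All (λ ℓ → R ℓ j ≡ false) L → weight L x j ≡ + 0
    weight-unrelated [] x j [] = refl
    weight-unrelated (ℓ ∷ L) x j (unrelated ∷ rest) rewrite unrelated =
      trans (ℤₚ.+-identityˡ _) (weight-unrelated L (x ∘ Fin.suc) j rest)

    weight-at-head : ∀ ℓ L x → All (T ∘ leader R) L → All (ℓ Fin.<_) L →
      weight (ℓ ∷ L) x ℓ ≡ x Fin.zero
    weight-at-head ℓ L x leads above
      rewrite R-refl ℓ | weight-unrelated L (x ∘ Fin.suc) ℓ (leaders-unrelated leads above) =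
      ℤₚ.+-identityʳ (x Fin.zero)

    -- At the t-th leader the weight is x_t plus contributions of earlier leaders only.
    triangular : ∀ L x → All (T ∘ leader R) L → AllPairs Fin._<_ L →
      (∀ {ℓ} → ℓ ∈ L → + p ∣ℤ weight L x ℓ) → ∀ t → + p ∣ℤ x t
    triangular (ℓ ∷ L) x (_ ∷ leads) (above ∷ sorted) p∣weight = λ where
        Fin.zero → p∣x₀
        (Fin.suc t) → triangular L (x ∘ Fin.suc) leads sorted p∣weight′ t
      where
      p∣x₀ : + p ∣ℤ x Fin.zero
      p∣x₀ = subst (+ p ∣ℤ_) (weight-at-head ℓ L x leads above) (p∣weight (here refl))
      p∣head-term : ∀ j → + p ∣ℤ (if R ℓ j then x Fin.zero else + 0)
      p∣head-term j with R ℓ j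
      ... | true = p∣x₀
      ... | false = divides (+ 0) refl
      p∣weight′ : ∀ {ℓ′} → ℓ′ ∈ L → + p ∣ℤ weight L (x ∘ Fin.suc) ℓ′
      p∣weight′ {ℓ′} ℓ′∈L = ∣m+n∣m⇒∣n (p∣weight (there ℓ′∈L)) (p∣head-term ℓ′)

    -- Fixing x_0 = 0 is what pins the common weight α to 0.
    pad : ∀ {N} → (Fin N → Fin p) → Fin (suc N) → ℤ
    pad u Fin.zero = + 0
    pad u (Fin.suc t) = + toℕ (u t)

    not-minimal : m ℕ.< q → (L : List (Fin m)) → All (T ∘ leader R) L → AllPairs Fin._<_ L →
      (Q : List Point) → 2 ℕ.+ length Q ℕ.≤ length L →
      (∀ P → IsPoint P → p ℕ.∣ ∣ c P ∣ → P ∉ Q → ∀ ℓ → + p ∣ℤ restr (R ℓ) P) → ¬ Minimal c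
    not-minimal _ [] _ _ _ ()
    not-minimal _ (_ ∷ []) _ _ _ (ℕ.s≤s ())
    not-minimal m<q (ℓ₀ ∷ L@(_ ∷ _)) leads sorted@((ℓ₀<ℓ₁ ∷ _) ∷ _) Q (ℕ.s≤s Q<L) outside minimal
      with u , u′ , (t , u≢u′) , agree ← collision (ℕ.nonTrivial⇒n>1 p {{prime⇒nonTrivial prime}}) Q<L
             (λ u s → residue (combo (ℓ₀ ∷ L) (pad u) (List.lookup Q s))) =
      u≢u′ (∣-difference⇒≡ (u t) (u′ t) (triangular (ℓ₀ ∷ L) d leads sorted divisible (Fin.suc t)))
      where
      open import Data.List.Membership.DecPropositional (VecP.≡-dec (Finₚ._≟_ {q})) using (_∈?_)
      d : Fin (suc (length L)) → ℤ
      d t = pad u t - pad u′ t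
      difference-supported : ∀ P → IsPoint P → p ℕ.∣ ∣ c P ∣ → + p ∣ℤ weighted (weight (ℓ₀ ∷ L) d) P
      difference-supported P isP p∣cP =
        subst (+ p ∣ℤ_) (trans (combo-difference (ℓ₀ ∷ L) (pad u) (pad u′) P) (combo≡weighted (ℓ₀ ∷ L) d P))
              (on-Q-or-not (P ∈? Q))
        where
        on-Q-or-not : Dec (P ∈ Q) → + p ∣ℤ combo (ℓ₀ ∷ L) (pad u) P - combo (ℓ₀ ∷ L) (pad u′) P
        on-Q-or-not (yes P∈Q) = residue-≡⇒∣- (combo (ℓ₀ ∷ L) (pad u) P) (combo (ℓ₀ ∷ L) (pad u′) P)
          (subst (λ P → residue (combo (ℓ₀ ∷ L) (pad u) P) ≡ residue (combo (ℓ₀ ∷ L) (pad u′) P))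
                 (sym (lookup-index P∈Q)) (agree (ListAny.index P∈Q)))
        on-Q-or-not (no P∉Q) = ∣m∣n⇒∣m-n (combo-∣ (ℓ₀ ∷ L) (pad u) P (outside P isP p∣cP P∉Q))
                                          (combo-∣ (ℓ₀ ∷ L) (pad u′) P (outside P isP p∣cP P∉Q))
      divisible : ∀ {ℓ} → ℓ ∈ ℓ₀ ∷ L → + p ∣ℤ weight (ℓ₀ ∷ L) d ℓ
      divisible {ℓ} _ = subst (+ p ∣ℤ_) (trans (cong (λ w → weight (ℓ₀ ∷ L) d ℓ - w) weight-ℓ₀≡0) (ℤₚ.+-identityʳ _))
        (minimal⇒weights-congruent m<q (<⇒1< ℓ₀<ℓ₁) minimal (weight (ℓ₀ ∷ L) d) difference-supported ℓ ℓ₀)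
        where
        weight-ℓ₀≡0 : weight (ℓ₀ ∷ L) d ℓ₀ ≡ + 0
        weight-ℓ₀≡0 = weight-at-head ℓ₀ L d (All.tail leads) (AllPairs.head sorted)

-- The size of ℋ_c and the partition ℍ_c^K

n≤n^2 : ∀ x → x ℕ.≤ x ℕ.^ 2
n≤n^2 zero = ℕ.z≤n
n≤n^2 (suc x) = ℕ.m≤m*n (suc x) (suc x ℕ.^ 1)

Δ≤q : ∀ {p h n q Δ} → q ≡ p ℕ.^ h → 2 ℕ.≤ h → IsDelta p h n q Δ → Δ ℕ.≤ q
Δ≤q {p} {h} {n} {q} {Δ} q≡p^h 2≤h (large , square) with ℕ.m≤n⇒m<n∨m≡n 2≤h
... | inj₁ 2<h = begin
  Δ                              ≤⟨ ℕ.m≤m*n Δ (2 ℕ.^ (n ℕ.∸ 2)) {{ℕ.m^n≢0 2 (n ℕ.∸ 2)}} ⟩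
  Δ ℕ.* 2 ℕ.^ (n ℕ.∸ 2)          ≤⟨ n≤n^2 _ ⟩
  (Δ ℕ.* 2 ℕ.^ (n ℕ.∸ 2)) ℕ.^ 2  ≤⟨ proj₁ (large 2<h) ⟩
  q                              ∎
  where open ℕ.≤-Reasoning
... | inj₂ 2≡h = begin
  Δ                 ≤⟨ ℕ.m≤m*n Δ (2 ℕ.^ n) {{ℕ.m^n≢0 2 n}} ⟩
  Δ ℕ.* 2 ℕ.^ n     ≤⟨ proj₁ (square (sym 2≡h)) ⟩
  p                 ≤⟨ n≤n^2 p ⟩
  p ℕ.^ 2           ≡⟨ cong (p ℕ.^_) 2≡h ⟩
  p ℕ.^ h           ≡⟨ sym q≡p^h ⟩
  q                 ∎
  where open ℕ.≤-Reasoning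

module Representation {q : ℕ} (F : FiniteField q) (p n : ℕ) {c : PG.Codeword F p n} (r : PG.Rep F p n c) where
  open PG F p n
  open Rep r
  open Parts r
  open import Data.Integer using (+_; ∣_∣)
  open import Data.List using (filterᵇ; []; _∷_)
  open import Data.List.Relation.Unary.All using (All)
  open import Data.List.Relation.Unary.AllPairs using (AllPairs)
  import Data.List.Relation.Unary.All.Properties as All
  import Data.List.Relation.Unary.AllPairs.Properties as AllPairs
  open import Data.List.Relation.Unary.Any using (here)
  open import Data.List.Relation.Unary.Any.Properties using (any⁺)
  open import Data.List.Membership.Propositional using (lose)
  open import Data.List.Membership.Propositional.Properties using (∈-concatMap⁺; ∈-filter⁺)
  open import Data.Bool using (_∧_)
  open import Data.Bool.Properties using (T-∧)
  open import Data.Bool.ListAction using (any)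
  open import Relation.Nullary.Decidable using (T?)
  open import Function.Bundles using (Equivalence)
  open import Data.Nat.DivMod using (m<n*o⇒m/o<n)

  size<Δ : ∀ {Δ} → wt c ℕ.+ θ (n ℕ.∸ 1) ℕ.≤ Δ ℕ.* θ (n ℕ.∸ 1) → m ℕ.< Δ
  size<Δ {Δ} wt+θ≤Δθ = subst (ℕ._< Δ) (sym m≡mc)
    (m<n*o⇒m/o<n (subst (ℕ._≤ Δ ℕ.* θ (n ℕ.∸ 1)) (ℕ.+-suc (wt c) (θpred (n ℕ.∸ 1))) wt+θ≤Δθ))

  reach-refl : ∀ R k i → reach R k i i ≡ true
  reach-refl R zero i = dec-true (i Finₚ.≟ i) refl
  reach-refl R (suc k) i rewrite reach-refl R k i = refl

  Hseq-refl : ∀ K i → Hseq K i i ≡ true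
  Hseq-refl zero i = dec-true (i Finₚ.≟ i) refl
  Hseq-refl (suc K) i = reach-refl (Hseq K) m i

  leaders : Rel → List (Fin m)
  leaders R = filterᵇ (leader R) (allFin m)

  leaders-leader : ∀ R → All (T ∘ leader R) (leaders R)
  leaders-leader R = All.all-filter (T? ∘ leader R) (allFin m)

  leaders-sorted : ∀ R → AllPairs Fin._<_ (leaders R)
  leaders-sorted R = AllPairs.filter⁺ (T? ∘ leader R) (AllPairs.tabulate⁺-< (λ i<j → i<j))

  ∈-vecs : ∀ {k} (v : Vec (Fin q) k) → v ∈ vecs k
  ∈-vecs [] = here refl
  ∈-vecs {suc k} (x ∷ v) =
    ∈-concatMap⁺ (λ y → map (y ∷_) (vecs k)) (lose (∈-allFin x) (∈-map⁺ (x ∷_) (∈-vecs v)))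

  outside-Pinf : ∀ R P → IsPoint P → p ℕ.∣ ∣ c P ∣ → P ∉ Pinf R → ∀ i → + p ∣ℤ restr (R i) P
  outside-Pinf R P isP p∣cP P∉Pinf i with p ℕ.∣? ∣ restr (R i) P ∣
  ... | yes p∣restr = ∣ᵤ⇒∣ p∣restr
  ... | no p∤restr = contradiction
    (∈-filter⁺ (T? ∘ λ P → hole P ∧ any (λ i → not (isZeroₚ (restr (R i) P))) (allFin m))
      (∈-filter⁺ (T? ∘ isNorm) (∈-vecs P) isP)
      (Equivalence.from T-∧ (⇒T-does (p ℕ.∣? ∣ c P ∣) p∣cP ,
         any⁺ _ (lose (∈-allFin i) (¬⇒T-not-does (p ℕ.∣? ∣ restr (R i) P ∣) p∤restr)))))
    P∉Pinf

open import Data.Nat using (ℕ; _≤_; _<_; _+_; _*_; _^_; _∸_)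
open import Data.Nat.Primality using (Prime)
open import Data.Product using (_×_)
open import Data.List using (length)
open import Relation.Nullary using (¬_)
open import Relation.Binary.PropositionalEquality using (_≡_)

theorem3p9 : {q : ℕ} (F : FiniteField q) (p h n : ℕ) → Prime p → q ≡ p ^ h
    → 2 ≤ h → 27 < q → 2 ≤ n
    → (2 < h → 32 ≤ q × 2 ^ (2 * n ∸ 4) ≤ q) → (h ≡ 2 → 2 ^ (2 * n) ≤ q)
    → (Δ : ℕ) → IsDelta p h n q Δ
    → (c : PG.Codeword F p n) → PG.InCode F p n c
    → PG.wt F p n c + PG.θ F p n (n ∸ 1) ≤ Δ * PG.θ F p n (n ∸ 1)
    → (r : PG.Rep F p n c) → (K : ℕ) → PG.Parts.Stable F p n r K
    → length (PG.Parts.Pinf F p n r (PG.Parts.Hseq F p n r K)) + 2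
    ≤ PG.Parts.numParts F p n r (PG.Parts.Hseq F p n r K)
    → ¬ PG.Minimal F p n c
theorem3p9 {q} F p h n p-prime q≡p^h 2≤h _ _ _ _ Δ isΔ c _ wt≤ r K _ count =
  not-minimal m<q (leaders R) (leaders-leader R) (leaders-sorted R) (Pinf R) enough-leaders (outside-Pinf R)
  where
  open PG.Parts F p n r using (Rel; Hseq; Pinf)
  open Representation F p n r
  R : Rel
  R = Hseq K
  open Reweighting.Combinations F p n p-prime r R (Hseq-refl K)
  m<q : PG.Rep.m r < q
  m<q = ℕ.<-≤-trans (size<Δ {Δ} wt≤) (Δ≤q {n = n} {Δ = Δ} q≡p^h 2≤h isΔ)
  enough-leaders : 2 + length (Pinf R) ≤ length (leaders R)
  enough-leaders = subst (_≤ length (leaders R)) (ℕ.+-comm (length (Pinf R)) 2) count
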